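{- Let $(X,A,m,\alpha,r)$ be a reversible micro-macro system. (a) For non-empty subsets $a_0,\dots,a_n\subseteq X$, $|[\![a_0,\dots,a_n]\!]|=|[\![ra_n,\dots,ra_0]\!]|$, and hence $[\alpha]_{a_0,\dots,a_n}=e^{S(a_n)-S(a_0)}[\alpha]_{ra_n,\dots,ra_0}$. (b) $(p,[\alpha^{ -1}]_\bullet)$ is the reversed process of $(p,[\alpha]_\bullet)$: for all $n$ and $a_0,\dots,a_n\in A$, $\Pr_{(p,[\alpha^{ -1}]_\bullet)}[X_0=a_0,\dots,X_n=a_n]=\Pr_{(p,[\alpha]_\bullet)}[X_0=a_n,\dots,X_n=a_0]$. (c) The process $(p,[\alpha]_\bullet)$ is reversible if and only if $|[\![a_0,\dots,a_n]\!]|=|[\![a_n,\dots,a_0]\!]|$ for all $n$ and all $a_0,\dots,a_n\in A$. (d) If $r$ is invariant, then $(p,[\alpha]_\bullet)$ is reversible.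
   Context: A micro-macro system $(X,A,m,\alpha)$ consists of finite sets $X$, $A$, a bijection $\alpha:X\to X$ and a surjection $m:X\to A$; identify $a\in A$ with $m^{ -1}(a)$. It is reversible with reversion $r:X\to X$ if $r^2=\mathrm{id}$ and $\alpha^{ -1}=r\alpha r$; $r$ is invariant if $mr=m$. For subsets $a_0,\dots,a_n\subseteq X$: $[\![a_0,\dots,a_n]\!]=\{i\in a_0:\alpha^t(i)\in a_t\text{ for }0\le t\le n\}$, $[\alpha]_{a_0,\dots,a_n}=|[\![a_0,\dots,a_n]\!]|/|a_0|$, $S(a)=\ln|a|$, $ra=r(a)$. $p_a=|a|/|X|$. For $q\in\mathrm{Prob}(A)$, $(q,[\alpha]_\bullet)$ is the stochastic process on $A^{\mathbb N}$ with $\Pr[X_0=a_0,\dots,X_n=a_n]=q_{a_0}[\alpha]_{a_0,\dots,a_n}$; $(q,[\alpha^{ -1}]_\bullet)$ is defined likewise with $\alpha^{ -1}$. The process $(p,[\alpha]_\bullet)$ is reversible if $\Pr[X_0=a_0,\dots,X_n=a_n]=\Pr[X_0=a_n,\dots,X_n=a_0]$ for all $n$ and $a_0,\dots,a_n$. -}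

module Defs where

open import Data.Nat using (ℕ; zero; suc)
open import Data.Bool using (Bool; true; false; _∧_; _∨_)
open import Data.Fin using (Fin; zero; suc; toℕ; opposite; _≟_)
open import Data.Fin.Subset using (Subset; ∣_∣; Nonempty)
open import Data.Vec using (tabulate; lookup)
open import Data.Integer using (+_)
open import Data.Rational using (ℚ; 0ℚ; _/_; _*_)
open import Data.Product using (∃; _×_)
open import Relation.Nullary.Decidable using (⌊_⌋)
open import Relation.Binary.PropositionalEquality using (_≡_)
open import Function.Bundles using (_↔_; Inverse; _⇔_)

allᵇ : ∀ {k} → (Fin k → Bool) → Bool
allᵇ {zero}  f = true
allᵇ {suc k} f = f zero ∧ allᵇ (λ i → f (suc i))

anyᵇ : ∀ {k} → (Fin k → Bool) → Bool
anyᵇ {zero}  f = false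
anyᵇ {suc k} f = f zero ∨ anyᵇ (λ i → f (suc i))

iter : ∀ {N} → (Fin N → Fin N) → ℕ → Fin N → Fin N
iter f zero    x = x
iter f (suc t) x = f (iter f t x)

image : ∀ {N} → (Fin N → Fin N) → Subset N → Subset N
image f a = tabulate (λ y → anyᵇ (λ x → lookup a x ∧ ⌊ f x ≟ y ⌋))

traj : ∀ {N n} → (Fin N → Fin N) → (Fin (suc n) → Subset N) → Subset N
traj f a = tabulate (λ i → allᵇ (λ t → lookup (a t) (iter f (toℕ t) i)))

-- the fraction p/q in ℚ (convention: value 0 when q = 0; only used with q ≠ 0)
frac : ℕ → ℕ → ℚ
frac p zero    = 0ℚ
frac p (suc q) = (+ p) / suc q

ratio : ∀ {N n} → (Fin N → Fin N) → (Fin (suc n) → Subset N) → ℚ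
ratio f a = frac ∣ traj f a ∣ ∣ a zero ∣

rev : ∀ {ℓ} {S : Set ℓ} {n} → (Fin (suc n) → S) → Fin (suc n) → S
rev a t = a (opposite t)

record ReversibleMMS : Set where
  field
    N K   : ℕ
    α     : Fin N ↔ Fin N
    m     : Fin N → Fin K
    m-surjective : ∀ (b : Fin K) → ∃ λ x → m x ≡ b
    r     : Fin N → Fin N
    r-involution : ∀ x → r (r x) ≡ x
    r-reverses   : ∀ x → Inverse.from α x ≡ r (Inverse.to α (r x))

  αf αinv : Fin N → Fin N
  αf   = Inverse.to α
  αinv = Inverse.from α

  -- the macrostate b ∈ A as the subset m⁻¹(b) ⊆ X
  macroset : Fin K → Subset N
  macroset b = tabulate (λ x → ⌊ m x ≟ b ⌋)

  p : Fin K → ℚ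
  p b = frac ∣ macroset b ∣ N

  Pr : (Fin K → ℚ) → (Fin N → Fin N) → ∀ {n} → (Fin (suc n) → Fin K) → ℚ
  Pr q f b = q (b zero) * ratio f (λ t → macroset (b t))

  ProcessReversible : Set
  ProcessReversible = ∀ n (b : Fin (suc n) → Fin K) → Pr p αf b ≡ Pr p αf (rev b)

  r-Invariant : Set
  r-Invariant = ∀ x → m (r x) ≡ m x

-- Reversibility transports trajectories backwards: if i runs through a₀, …, aₙ under α, then
-- r(αⁿ i) runs through r aₙ, …, r a₀, because r α r = α⁻¹. As i ↦ r(αⁿ i) is a bijection of X,
-- both trajectory sets have the same size, and dividing by |a₀| gives the ratio formula of (a).
-- Likewise i ↦ α⁻ⁿ i matches α⁻¹-trajectories through a₀, …, aₙ with α-trajectories through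
-- aₙ, …, a₀, which is (b). Since p_{b₀} [α]_{b₀…bₙ} = |⟦b₀, …, bₙ⟧| / |X|, path probabilities
-- are path counts, giving (c); and an invariant r fixes every macrostate, so (a) becomes the
-- count symmetry of (c), giving (d).
module Submission where

open import Defs
open import Data.Nat using (ℕ; suc)
open import Data.Fin using (Fin; zero; fromℕ)
open import Data.Fin.Subset using (Subset; ∣_∣; Nonempty)
open import Data.Rational using (_*_)
open import Data.Product using (_×_)
open import Relation.Binary.PropositionalEquality using (_≡_)
open import Function.Bundles using (_⇔_)

open import Data.Bool using (Bool; true; false; _∧_; _∨_; if_then_else_)
import Data.Bool.Properties as Bool
open import Data.Nat as ℕ using (zero; _+_; _∸_; _≤_; _<_)
import Data.Nat.Properties as ℕ
open import Data.Nat.Tactic.RingSolver using (solve-∀)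
open import Data.Integer as ℤ using (+_)
import Data.Integer.Properties as ℤ
open import Data.Rational as ℚ using (toℚᵘ)
import Data.Rational.Properties as ℚ
open import Data.Rational.Unnormalised as ℚᵘ using (mkℚᵘ; *≡*)
import Data.Rational.Unnormalised.Properties as ℚᵘ
open import Data.Fin using (suc; toℕ; opposite; _≟_)
import Data.Fin.Properties as Fin
open import Data.Fin.Subset using (_∈_)
open import Data.Fin.Subset.Properties using (∣p∣≤n; p⊆q⇒∣p∣≤∣q∣; ∣⁅x⁆∣≡1; x∈⁅y⁆⇒x≡y)
open import Data.Fin.Permutation as Perm
  using (Permutation′; permutation; _⟨$⟩ʳ_; _⟨$⟩ˡ_; _∘ₚ_; inverseˡ; inverseʳ)
open import Data.Vec using (tabulate; lookup)
open import Data.Vec.Properties using (tabulate-cong; lookup∘tabulate; tabulate∘lookup; lookup⇒[]=)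
open import Data.Product using (_,_)
open import Function using (_∘_)
open import Function.Bundles using (mk⇔)
open import Relation.Binary.PropositionalEquality using (_≢_; refl; sym; trans; cong; cong₂; subst; _≗_; module ≡-Reasoning)
open import Relation.Nullary.Decidable using (⌊_⌋; isYes≗does; dec-true; dec-false)
open import Algebra.Properties.CommutativeMonoid.Sum ℕ.+-0-commutativeMonoid using (sum; sum-permute)

private
  variable
    k n : ℕ

allᵇ-sound : (f : Fin k → Bool) → allᵇ f ≡ true → ∀ t → f t ≡ true
allᵇ-sound {suc k} f all-f t with f zero in f0≡
allᵇ-sound {suc k} f all-f zero    | true = f0≡
allᵇ-sound {suc k} f all-f (suc t) | true = allᵇ-sound (f ∘ suc) all-f t

allᵇ-complete : (f : Fin k → Bool) → (∀ t → f t ≡ true) → allᵇ f ≡ true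
allᵇ-complete {zero}  f f≡true = refl
allᵇ-complete {suc k} f f≡true rewrite f≡true zero = allᵇ-complete (f ∘ suc) (f≡true ∘ suc)

allᵇ-cong : {f g : Fin k → Bool} → f ≗ g → allᵇ f ≡ allᵇ g
allᵇ-cong {zero}  f≗g = refl
allᵇ-cong {suc k} f≗g = cong₂ _∧_ (f≗g zero) (allᵇ-cong (f≗g ∘ suc))

allᵇ-∘-surjective : (f : Fin k → Bool) (σ τ : Fin k → Fin k) → (∀ t → σ (τ t) ≡ t) →
                    allᵇ (f ∘ σ) ≡ allᵇ f
allᵇ-∘-surjective f σ τ στ = Bool.⇔→≡ (mk⇔
  (λ all-fσ → allᵇ-complete f λ t → subst (λ u → f u ≡ true) (στ t) (allᵇ-sound (f ∘ σ) all-fσ (τ t)))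
  (λ all-f → allᵇ-complete (f ∘ σ) (allᵇ-sound f all-f ∘ σ)))

anyᵇ-false : (f : Fin k → Bool) → (∀ x → f x ≡ false) → anyᵇ f ≡ false
anyᵇ-false {zero}  f f≡false = refl
anyᵇ-false {suc k} f f≡false rewrite f≡false zero = anyᵇ-false (f ∘ suc) (f≡false ∘ suc)

anyᵇ-unique : (f : Fin k → Bool) (x₀ : Fin k) → (∀ x → x ≢ x₀ → f x ≡ false) → anyᵇ f ≡ f x₀
anyᵇ-unique f zero f≡false = trans
  (cong (f zero ∨_) (anyᵇ-false (f ∘ suc) λ x → f≡false (suc x) λ ()))
  (Bool.∨-identityʳ (f zero))
anyᵇ-unique f (suc x₀) f≡false rewrite f≡false zero (λ ()) =
  anyᵇ-unique (f ∘ suc) x₀ λ x x≢x₀ → f≡false (suc x) (x≢x₀ ∘ Fin.suc-injective)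

lookup-image : ∀ {N} → (π : Permutation′ N) (p : Subset N) (y : Fin N) →
               lookup (image (π ⟨$⟩ʳ_) p) y ≡ lookup p (π ⟨$⟩ˡ y)
lookup-image π p y = begin
  lookup (image (π ⟨$⟩ʳ_) p) y                ≡⟨ lookup∘tabulate _ y ⟩
  anyᵇ (λ x → lookup p x ∧ ⌊ π ⟨$⟩ʳ x ≟ y ⌋)  ≡⟨ anyᵇ-unique _ x₀ only-x₀ ⟩
  lookup p x₀ ∧ ⌊ π ⟨$⟩ʳ x₀ ≟ y ⌋             ≡⟨ cong (lookup p x₀ ∧_) (trans (isYes≗does (_ ≟ y)) (dec-true (_ ≟ y) (inverseʳ π))) ⟩
  lookup p x₀ ∧ true                          ≡⟨ Bool.∧-identityʳ _ ⟩
  lookup p x₀                                 ∎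
  where
  open ≡-Reasoning
  x₀ : Fin _
  x₀ = π ⟨$⟩ˡ y
  only-x₀ : ∀ x → x ≢ x₀ → (lookup p x ∧ ⌊ π ⟨$⟩ʳ x ≟ y ⌋) ≡ false
  only-x₀ x x≢x₀ = trans
    (cong (lookup p x ∧_) (trans (isYes≗does (_ ≟ y))
      (dec-false (_ ≟ y) λ πx≡y → x≢x₀ (trans (sym (inverseˡ π)) (cong (π ⟨$⟩ˡ_) πx≡y)))))
    (Bool.∧-zeroʳ _)

indicator : Bool → ℕ
indicator b = if b then 1 else 0

∣tabulate∣≡sum-indicator : ∀ {N} → (f : Fin N → Bool) → ∣ tabulate f ∣ ≡ sum (indicator ∘ f)
∣tabulate∣≡sum-indicator {zero}  f = refl
∣tabulate∣≡sum-indicator {suc N} f with f zero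
... | true  = cong suc (∣tabulate∣≡sum-indicator (f ∘ suc))
... | false = ∣tabulate∣≡sum-indicator (f ∘ suc)

∣tabulate∣-permute : ∀ {N} → (π : Permutation′ N) (f : Fin N → Bool) → ∣ tabulate (f ∘ (π ⟨$⟩ʳ_)) ∣ ≡ ∣ tabulate f ∣
∣tabulate∣-permute π f = begin
  ∣ tabulate (f ∘ (π ⟨$⟩ʳ_)) ∣     ≡⟨ ∣tabulate∣≡sum-indicator (f ∘ (π ⟨$⟩ʳ_)) ⟩
  sum (indicator ∘ f ∘ (π ⟨$⟩ʳ_))  ≡⟨ sum-permute (indicator ∘ f) π ⟨
  sum (indicator ∘ f)              ≡⟨ ∣tabulate∣≡sum-indicator f ⟨
  ∣ tabulate f ∣                   ∎
  where open ≡-Reasoning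

∣image∣≡∣p∣ : ∀ {N} → (π : Permutation′ N) (p : Subset N) → ∣ image (π ⟨$⟩ʳ_) p ∣ ≡ ∣ p ∣
∣image∣≡∣p∣ π p = begin
  ∣ image (π ⟨$⟩ʳ_) p ∣                      ≡⟨ cong ∣_∣ (tabulate∘lookup (image (π ⟨$⟩ʳ_) p)) ⟨
  ∣ tabulate (lookup (image (π ⟨$⟩ʳ_) p)) ∣  ≡⟨ cong ∣_∣ (tabulate-cong (lookup-image π p)) ⟩
  ∣ tabulate (lookup p ∘ (π ⟨$⟩ˡ_)) ∣        ≡⟨ ∣tabulate∣-permute (Perm.flip π) (lookup p) ⟩
  ∣ tabulate (lookup p) ∣                    ≡⟨ cong ∣_∣ (tabulate∘lookup p) ⟩
  ∣ p ∣                                      ∎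
  where open ≡-Reasoning

nonempty⇒∣p∣>0 : ∀ {N} {p : Subset N} → Nonempty p → 0 < ∣ p ∣
nonempty⇒∣p∣>0 {p = p} (x , x∈p) = subst (_≤ ∣ p ∣) (∣⁅x⁆∣≡1 x)
  (p⊆q⇒∣p∣≤∣q∣ λ y∈⁅x⁆ → subst (_∈ p) (sym (x∈⁅y⁆⇒x≡y x y∈⁅x⁆)) x∈p)

iter-+ : ∀ {N} → (f : Fin N → Fin N) (s t : ℕ) (x : Fin N) → iter f (s + t) x ≡ iter f s (iter f t x)
iter-+ f zero    t x = refl
iter-+ f (suc s) t x = cong f (iter-+ f s t x)

iter-sucʳ : ∀ {N} → (f : Fin N → Fin N) (t : ℕ) (x : Fin N) → iter f (suc t) x ≡ iter f t (f x)
iter-sucʳ f zero    x = refl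
iter-sucʳ f (suc t) x = cong f (iter-sucʳ f t x)

iter-inverse : ∀ {N} → (f g : Fin N → Fin N) → (∀ x → g (f x) ≡ x) → ∀ t x → iter g t (iter f t x) ≡ x
iter-inverse f g gf zero    x = refl
iter-inverse f g gf (suc t) x = begin
  g (iter g t (iter f (suc t) x)) ≡⟨ cong (g ∘ iter g t) (iter-sucʳ f t x) ⟩
  g (iter g t (iter f t (f x)))   ≡⟨ cong g (iter-inverse f g gf t (f x)) ⟩
  g (f x)                         ≡⟨ gf x ⟩
  x                               ∎
  where open ≡-Reasoning

iter-cancel-opposite : ∀ {N} → (f g : Fin N → Fin N) → (∀ x → g (f x) ≡ x) →
                       (t : Fin (suc n)) (x : Fin N) → iter g (toℕ t) (iter f n x) ≡ iter f (toℕ (opposite t)) x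
iter-cancel-opposite {n = n} f g gf t x = begin
  iter g (toℕ t) (iter f n x)                           ≡⟨ cong (λ s → iter g (toℕ t) (iter f s x)) (ℕ.m+[n∸m]≡n t≤n) ⟨
  iter g (toℕ t) (iter f (toℕ t + (n ∸ toℕ t)) x)       ≡⟨ cong (iter g (toℕ t)) (iter-+ f (toℕ t) (n ∸ toℕ t) x) ⟩
  iter g (toℕ t) (iter f (toℕ t) (iter f (n ∸ toℕ t) x)) ≡⟨ iter-inverse f g gf (toℕ t) _ ⟩
  iter f (n ∸ toℕ t) x                                  ≡⟨ cong (λ s → iter f s x) (Fin.opposite-prop t) ⟨
  iter f (toℕ (opposite t)) x                           ∎
  where
  open ≡-Reasoning
  t≤n : toℕ t ≤ n
  t≤n = Fin.toℕ≤pred[n] t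

iter-commute : ∀ {N} → (f g φ : Fin N → Fin N) → (∀ x → φ (f x) ≡ g (φ x)) → ∀ t x → φ (iter f t x) ≡ iter g t (φ x)
iter-commute f g φ φf≡gφ zero    x = refl
iter-commute f g φ φf≡gφ (suc t) x = trans (φf≡gφ (iter f t x)) (cong g (iter-commute f g φ φf≡gφ t x))

iterₚ : ∀ {N} → Permutation′ N → ℕ → Permutation′ N
iterₚ π t = permutation (iter (π ⟨$⟩ʳ_) t) (iter (π ⟨$⟩ˡ_) t)
  (iter-inverse _ _ (λ _ → inverseʳ π) t) (iter-inverse _ _ (λ _ → inverseˡ π) t)

traj-cong : ∀ {N} → (f : Fin N → Fin N) {a b : Fin (suc n) → Subset N} → (∀ t → a t ≡ b t) → traj f a ≡ traj f b
traj-cong f a≡b = tabulate-cong λ i → allᵇ-cong λ t → cong (λ s → lookup s (iter f (toℕ t) i)) (a≡b t)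

∣traj∣-reverse : ∀ {N} → (f g : Fin N → Fin N) (φ : Permutation′ N) (a b : Fin (suc n) → Subset N) →
                 (∀ i t → lookup (b t) (iter g (toℕ t) (φ ⟨$⟩ʳ i))
                        ≡ lookup (a (opposite t)) (iter f (toℕ (opposite t)) i)) →
                 ∣ traj f a ∣ ≡ ∣ traj g b ∣
∣traj∣-reverse {N = N} f g φ a b b∘φ≡a∘opposite = begin
  ∣ traj f a ∣                                ≡⟨ cong ∣_∣ (tabulate-cong same-membership) ⟩
  ∣ tabulate (allᵇ ∘ b-visits ∘ (φ ⟨$⟩ʳ_)) ∣  ≡⟨ ∣tabulate∣-permute φ (allᵇ ∘ b-visits) ⟩
  ∣ traj g b ∣                                ∎
  where
  open ≡-Reasoning
  a-visits b-visits : Fin N → Fin (suc _) → Bool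
  a-visits i t = lookup (a t) (iter f (toℕ t) i)
  b-visits j t = lookup (b t) (iter g (toℕ t) j)
  same-membership : ∀ i → allᵇ (a-visits i) ≡ allᵇ (b-visits (φ ⟨$⟩ʳ i))
  same-membership i = sym (trans (allᵇ-cong (b∘φ≡a∘opposite i))
    (allᵇ-∘-surjective (a-visits i) opposite opposite Fin.opposite-involutive))

toℚᵘ-frac : ∀ T N → toℚᵘ (frac T (suc N)) ℚᵘ.≃ mkℚᵘ (+ T) N
toℚᵘ-frac T N = ℚ.toℚᵘ-fromℚᵘ (mkℚᵘ (+ T) N)

mkℚᵘ-*-cancel : ∀ c N T → mkℚᵘ (+ suc c) N ℚᵘ.* mkℚᵘ (+ T) c ℚᵘ.≃ mkℚᵘ (+ T) N
mkℚᵘ-*-cancel c N T = *≡* (begin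
  (+ suc c ℤ.* + T) ℤ.* + suc N ≡⟨ cong (ℤ._* + suc N) (ℤ.pos-* (suc c) T) ⟨
  + (suc c ℕ.* T) ℤ.* + suc N   ≡⟨ ℤ.pos-* (suc c ℕ.* T) (suc N) ⟨
  + (suc c ℕ.* T ℕ.* suc N)     ≡⟨ cong +_ (*-rearrange (suc c) T (suc N)) ⟩
  + (T ℕ.* (suc N ℕ.* suc c))   ≡⟨ ℤ.pos-* T (suc N ℕ.* suc c) ⟩
  + T ℤ.* + (suc N ℕ.* suc c)   ∎)
  where
  open ≡-Reasoning
  *-rearrange : ∀ a b d → a ℕ.* b ℕ.* d ≡ b ℕ.* (d ℕ.* a)
  *-rearrange = solve-∀

frac-*-frac : ∀ {k} → 0 < k → ∀ N T → frac k N * frac T k ≡ frac T N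
frac-*-frac {suc c} _ zero    T = ℚ.*-zeroˡ (frac T (suc c))
frac-*-frac {suc c} _ (suc N) T = ℚ.toℚᵘ-injective (begin
  toℚᵘ (frac (suc c) (suc N) * frac T (suc c))           ≈⟨ ℚ.toℚᵘ-homo-* (frac (suc c) (suc N)) (frac T (suc c)) ⟩
  toℚᵘ (frac (suc c) (suc N)) ℚᵘ.* toℚᵘ (frac T (suc c)) ≈⟨ ℚᵘ.*-cong (toℚᵘ-frac (suc c) N) (toℚᵘ-frac T c) ⟩
  mkℚᵘ (+ suc c) N ℚᵘ.* mkℚᵘ (+ T) c                     ≈⟨ mkℚᵘ-*-cancel c N T ⟩
  mkℚᵘ (+ T) N                                            ≈⟨ toℚᵘ-frac T N ⟨
  toℚᵘ (frac T (suc N))                                   ∎)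
  where open ℚᵘ.≃-Reasoning

frac-injective : ∀ {N} → 0 < N → ∀ T T′ → frac T N ≡ frac T′ N → T ≡ T′
frac-injective {suc N} _ T T′ T/N≡T′/N with ℚᵘ.≃-trans (ℚᵘ.≃-sym (toℚᵘ-frac T N)) (ℚᵘ.≃-trans (ℚ.toℚᵘ-cong T/N≡T′/N) (toℚᵘ-frac T′ N))
... | *≡* T*N≡T′*N = ℕ.*-cancelʳ-≡ T T′ (suc N) (ℤ.+-injective (begin
  + (T ℕ.* suc N)  ≡⟨ ℤ.pos-* T (suc N) ⟩
  + T ℤ.* + suc N  ≡⟨ T*N≡T′*N ⟩
  + T′ ℤ.* + suc N ≡⟨ ℤ.pos-* T′ (suc N) ⟨
  + (T′ ℕ.* suc N) ∎))
  where open ≡-Reasoning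

module Reversible (S : ReversibleMMS) where
  open ReversibleMMS S

  r-permutation : Permutation′ N
  r-permutation = permutation r r r-involution r-involution

  r-αf : ∀ x → r (αf x) ≡ αinv (r x)
  r-αf x = trans (cong (r ∘ αf) (sym (r-involution x))) (sym (r-reverses (r x)))

  r-iter-αf-r : ∀ t x → r (iter αf t (r x)) ≡ iter αinv t x
  r-iter-αf-r t x = trans (iter-commute αf αinv r r-αf t (r x)) (cong (iter αinv t) (r-involution x))

  ∣traj∣≡∣traj-reverse-image∣ : ∀ n (a : Fin (suc n) → Subset N) →
                                ∣ traj αf a ∣ ≡ ∣ traj αf (rev (λ t → image r (a t))) ∣
  ∣traj∣≡∣traj-reverse-image∣ n a =
    ∣traj∣-reverse αf αf (iterₚ α n ∘ₚ r-permutation) a (rev (λ t → image r (a t))) λ i t → begin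
    lookup (image r (a (opposite t))) (iter αf (toℕ t) (r (iter αf n i))) ≡⟨ lookup-image r-permutation (a (opposite t)) _ ⟩
    lookup (a (opposite t)) (r (iter αf (toℕ t) (r (iter αf n i))))       ≡⟨ cong (lookup (a (opposite t))) (r-iter-αf-r (toℕ t) _) ⟩
    lookup (a (opposite t)) (iter αinv (toℕ t) (iter αf n i))             ≡⟨ cong (lookup (a (opposite t))) (iter-cancel-opposite αf αinv (λ _ → inverseˡ α) t i) ⟩
    lookup (a (opposite t)) (iter αf (toℕ (opposite t)) i)                ∎
    where open ≡-Reasoning

  ratio-reverse-image : ∀ n (a : Fin (suc n) → Subset N) → Nonempty (a (fromℕ n)) →
                        ratio αf a ≡ frac ∣ a (fromℕ n) ∣ ∣ a zero ∣ * ratio αf (rev (λ t → image r (a t)))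
  ratio-reverse-image n a aₙ≠∅ = begin
    ratio αf a                                                   ≡⟨ frac-*-frac (nonempty⇒∣p∣>0 aₙ≠∅) (∣ a zero ∣) (∣ traj αf a ∣) ⟨
    frac (∣ aₙ ∣) (∣ a zero ∣) * frac (∣ traj αf a ∣) (∣ aₙ ∣)      ≡⟨ cong₂ (λ T k → frac (∣ aₙ ∣) (∣ a zero ∣) * frac T k)
                                                                      (∣traj∣≡∣traj-reverse-image∣ n a) (sym (∣image∣≡∣p∣ r-permutation aₙ)) ⟩
    frac (∣ aₙ ∣) (∣ a zero ∣) * ratio αf aʳ                        ∎
    where
    open ≡-Reasoning
    aₙ : Subset N
    aₙ = a (fromℕ n)
    aʳ : Fin (suc n) → Subset N
    aʳ = rev (λ t → image r (a t))

  ∣traj-αinv∣≡∣traj-αf-rev∣ : ∀ n (a : Fin (suc n) → Subset N) → ∣ traj αinv a ∣ ≡ ∣ traj αf (rev a) ∣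
  ∣traj-αinv∣≡∣traj-αf-rev∣ n a = ∣traj∣-reverse αinv αf (iterₚ (Perm.flip α) n) a (rev a) λ i t →
    cong (lookup (a (opposite t))) (iter-cancel-opposite αinv αf (λ _ → inverseʳ α) t i)

  macroset-nonempty : ∀ b → Nonempty (macroset b)
  macroset-nonempty b with m-surjective b
  ... | x , mx≡b = x , lookup⇒[]= x (macroset b)
    (trans (lookup∘tabulate _ x) (trans (isYes≗does (m x ≟ b)) (dec-true (m x ≟ b) mx≡b)))

  Pr-p≡frac-∣traj∣ : ∀ f {n} (b : Fin (suc n) → Fin K) → Pr p f b ≡ frac ∣ traj f (macroset ∘ b) ∣ N
  Pr-p≡frac-∣traj∣ f b = frac-*-frac (nonempty⇒∣p∣>0 (macroset-nonempty (b zero))) N _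

  Pr-αinv≡Pr-αf-rev : ∀ n (b : Fin (suc n) → Fin K) → Pr p αinv b ≡ Pr p αf (rev b)
  Pr-αinv≡Pr-αf-rev n b = begin
    Pr p αinv b                               ≡⟨ Pr-p≡frac-∣traj∣ αinv b ⟩
    frac (∣ traj αinv (macroset ∘ b) ∣) N     ≡⟨ cong (λ T → frac T N) (∣traj-αinv∣≡∣traj-αf-rev∣ n (macroset ∘ b)) ⟩
    frac (∣ traj αf (macroset ∘ rev b) ∣) N   ≡⟨ Pr-p≡frac-∣traj∣ αf (rev b) ⟨
    Pr p αf (rev b)                           ∎
    where open ≡-Reasoning

  ∣traj∣-Symmetric : Set
  ∣traj∣-Symmetric = ∀ n (b : Fin (suc n) → Fin K) → ∣ traj αf (macroset ∘ b) ∣ ≡ ∣ traj αf (macroset ∘ rev b) ∣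

  ∣traj∣-symmetric⇒reversible : ∣traj∣-Symmetric → ProcessReversible
  ∣traj∣-symmetric⇒reversible symmetric n b = begin
    Pr p αf b                              ≡⟨ Pr-p≡frac-∣traj∣ αf b ⟩
    frac (∣ traj αf (macroset ∘ b) ∣) N     ≡⟨ cong (λ T → frac T N) (symmetric n b) ⟩
    frac (∣ traj αf (macroset ∘ rev b) ∣) N ≡⟨ Pr-p≡frac-∣traj∣ αf (rev b) ⟨
    Pr p αf (rev b)                        ∎
    where open ≡-Reasoning

  reversible⇒∣traj∣-symmetric : ProcessReversible → ∣traj∣-Symmetric
  reversible⇒∣traj∣-symmetric reversible n b = frac-injective N>0 _ _ (begin
    frac (∣ traj αf (macroset ∘ b) ∣) N     ≡⟨ Pr-p≡frac-∣traj∣ αf b ⟨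
    Pr p αf b                              ≡⟨ reversible n b ⟩
    Pr p αf (rev b)                        ≡⟨ Pr-p≡frac-∣traj∣ αf (rev b) ⟩
    frac (∣ traj αf (macroset ∘ rev b) ∣) N ∎)
    where
    open ≡-Reasoning
    N>0 : 0 < N
    N>0 = ℕ.<-≤-trans (nonempty⇒∣p∣>0 (macroset-nonempty (b zero))) (∣p∣≤n (macroset (b zero)))

  image-r-macroset : r-Invariant → ∀ b → image r (macroset b) ≡ macroset b
  image-r-macroset r-invariant b = begin
    image r (macroset b)                      ≡⟨ tabulate∘lookup (image r (macroset b)) ⟨
    tabulate (lookup (image r (macroset b)))  ≡⟨ tabulate-cong (lookup-image r-permutation (macroset b)) ⟩
    tabulate (lookup (macroset b) ∘ r)        ≡⟨ tabulate-cong (λ x → lookup∘tabulate _ (r x)) ⟩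
    tabulate (λ x → ⌊ m (r x) ≟ b ⌋)          ≡⟨ tabulate-cong (λ x → cong (λ y → ⌊ y ≟ b ⌋) (r-invariant x)) ⟩
    macroset b                                ∎
    where open ≡-Reasoning

  invariant⇒reversible : r-Invariant → ProcessReversible
  invariant⇒reversible r-invariant = ∣traj∣-symmetric⇒reversible λ n b → begin
    ∣ traj αf (macroset ∘ b) ∣                                 ≡⟨ ∣traj∣≡∣traj-reverse-image∣ n (macroset ∘ b) ⟩
    ∣ traj αf (rev (λ t → image r (macroset (b t)))) ∣         ≡⟨ cong ∣_∣ (traj-cong αf (image-r-macroset r-invariant ∘ rev b)) ⟩
    ∣ traj αf (macroset ∘ rev b) ∣                             ∎
    where open ≡-Reasoning

theorem22 : (S : ReversibleMMS) → let open ReversibleMMS S in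
    (∀ n (a : Fin (suc n) → Subset N) → (∀ t → Nonempty (a t)) →
        (∣ traj αf a ∣ ≡ ∣ traj αf (rev (λ t → image r (a t))) ∣)
      × (ratio αf a ≡ frac ∣ a (fromℕ n) ∣ ∣ a zero ∣ * ratio αf (rev (λ t → image r (a t)))))
    × (∀ n (b : Fin (suc n) → Fin K) → Pr p αinv b ≡ Pr p αf (rev b))
    × (ProcessReversible ⇔ (∀ n (b : Fin (suc n) → Fin K) →
          ∣ traj αf (λ t → macroset (b t)) ∣ ≡ ∣ traj αf (λ t → macroset (rev b t)) ∣))
    × (r-Invariant → ProcessReversible)
theorem22 S =
    (λ n a a≠∅ → ∣traj∣≡∣traj-reverse-image∣ n a , ratio-reverse-image n a (a≠∅ (fromℕ n)))
  , Pr-αinv≡Pr-αf-rev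
  , mk⇔ reversible⇒∣traj∣-symmetric ∣traj∣-symmetric⇒reversible
  , invariant⇒reversible
  where open Reversible S
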